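{- Let $\Sigma$ be a finite alphabet of size $\sigma\ge2$ and $k\ge2$. For every $f\in\Sigma^{k-1}$ and every weakly connected component $\chi$ of $G_{\mathrm{MDS}}(\sigma,k)$, there exists an $f$-terminal MDS in $\chi$.
   Context: $D_k$ is the de Bruijn graph with vertex set $\Sigma^k$ and edges $u\to v$ whenever the length-$(k-1)$ suffix of $u$ equals the length-$(k-1)$ prefix of $v$. A decycling set is $M\subseteq\Sigma^k$ with $D_k\setminus M$ acyclic; an MDS is a decycling set of minimum size. For $f\in\Sigma^{k-1}$, $\mathrm{lc}(f)=\{af:a\in\Sigma\}$, $\mathrm{rc}(f)=\{fa:a\in\Sigma\}$. The F-move $f$ is valid in $M$ if $\mathrm{lc}(f)\subseteq M$, and then $fM=(M\setminus\mathrm{lc}(f))\cup\mathrm{rc}(f)$. The MDS graph $G_{\mathrm{MDS}}(\sigma,k)$ has all MDSs as nodes and edges $M\to fM$ for valid F-moves $f$. An MDS $M$ is $f$-terminal if $f$ is the only F-move valid in $M$. -}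

module Defs where

open import Data.Nat using (ℕ; zero; suc; _+_; _≤_)
open import Data.Fin using (Fin)
open import Data.Fin.Properties using () renaming (_≟_ to _≟F_)
open import Data.Vec using (Vec; []; _∷_; tail; init)
open import Data.Vec.Properties using (≡-dec)
open import Data.List using (List; [_]; map; concatMap)
open import Data.Nat.ListAction using (sum)
open import Data.List using () renaming (allFin to allFinL)
open import Data.Bool using (Bool; true; false; if_then_else_; _∨_; _∧_; not)
open import Data.Product using (Σ; _×_; ∃)
open import Relation.Nullary using (¬_; does)
open import Relation.Binary.PropositionalEquality using (_≡_)
open import Relation.Binary.Construct.Closure.Transitive using (TransClosure)
open import Relation.Binary.Construct.Closure.Equivalence using (EqClosure)

-- Alphabet Σ = Fin σ.  We write k = suc n, so Σ^k = Vec (Fin σ) (suc n)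
-- and Σ^(k-1) = Vec (Fin σ) n.
module _ (σ : ℕ) where

  Word : ℕ → Set
  Word m = Vec (Fin σ) m

  _≟W_ : {m : ℕ} → (u v : Word m) → Relation.Nullary.Dec (u ≡ v)
  _≟W_ = ≡-dec _≟F_

  allWords : (m : ℕ) → List (Word m)
  allWords zero    = [ [] ]
  allWords (suc m) = concatMap (λ a → map (a ∷_) (allWords m)) (allFinL σ)

  VSet : ℕ → Set
  VSet n = Word (suc n) → Bool

  size : {n : ℕ} → VSet n → ℕ
  size {n} M = sum (map (λ w → if M w then 1 else 0) (allWords (suc n)))

  EdgeOutside : {n : ℕ} → VSet n → Word (suc n) → Word (suc n) → Set
  EdgeOutside M u v = (M u ≡ false) × (M v ≡ false) × (tail u ≡ init v)

  Decycling : {n : ℕ} → VSet n → Set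
  Decycling M = ∀ u → ¬ TransClosure (EdgeOutside M) u u

  MDS : {n : ℕ} → VSet n → Set
  MDS {n} M = Decycling M × (∀ (M' : VSet n) → Decycling M' → size M ≤ size M')

  Valid : {n : ℕ} → Word n → VSet n → Set
  Valid f M = ∀ (a : Fin σ) → M (a ∷ f) ≡ true

  -- fM = (M \ lc(f)) ∪ rc(f)
  move : {n : ℕ} → Word n → VSet n → VSet n
  move f M w = does (init w ≟W f) ∨ (not (does (tail w ≟W f)) ∧ M w)

  -- edge M → N of G_MDS (sets compared extensionally)
  MDSEdge : {n : ℕ} → VSet n → VSet n → Set
  MDSEdge {n} M N = MDS M × MDS N × Σ (Word n) (λ f → Valid f M × (∀ w → N w ≡ move f M w))

  SameComponent : {n : ℕ} → VSet n → VSet n → Set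
  SameComponent = EqClosure MDSEdge

  Terminal : {n : ℕ} → Word n → VSet n → Set
  Terminal {n} f M = MDS M × Valid f M × (∀ (g : Word n) → Valid g M → g ≡ f)

-- An F-move f removes lc(f) and adds rc(f); both have σ elements, so a valid move
-- never increases |M|. It never creates a cycle either: a vertex of lc(f) lying on a
-- cycle of D_k ∖ fM would be followed on it by a vertex of rc(f) ⊆ fM. Hence valid
-- F-moves stay in G_MDS. A decycling set always admits a valid F-move, since otherwise
-- one could walk backwards outside M forever and, D_k being finite, close a cycle.
--
-- Starting from M, apply valid F-moves other than f as long as possible. If c g counts
-- the applications of g so far, then c (tail w) ≤ c (init w) + 1 for every w ∈ Σ^k, and
-- shifting f into any g one letter at a time gives c g ≤ c f + (k - 1) = k - 1. So only
-- finitely many moves are possible, and the process halts in an f-terminal MDS.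
module Submission where

open import Defs
open import Data.Bool using (Bool; true; false; if_then_else_; _∧_; not)
  renaming (_≟_ to _≟B_)
open import Data.Bool.Properties using (∨-conicalʳ; ¬-not)
open import Data.Empty using (⊥-elim)
open import Data.Fin using (Fin; zero; suc; toℕ; combine)
open import Data.Fin.Properties using (pigeonhole; combine-injective; all?; ¬∀⟶∃¬)
  renaming (_≟_ to _≟F_)
open import Data.List using (List; []; _∷_; _++_; map; concatMap; tabulate; length)
open import Data.List.Properties using (map-++; ++-assoc; ++-identityʳ; ∷-injectiveʳ)
open import Data.List.Membership.Propositional using (_∈_; lose)
open import Data.List.Membership.Propositional.Properties using (∈-map⁺; ∈-concatMap⁺; ∈-allFin)
open import Data.List.Relation.Unary.Any using (here; any?; satisfied)
open import Data.Nat using (ℕ; zero; suc; pred; _+_; _*_; _^_; _≤_; _<_; z≤n; s≤s)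
open import Data.Nat.ListAction using (sum)
open import Data.Nat.ListAction.Properties using (sum-++)
open import Data.Nat.Properties
  using (module ≤-Reasoning; +-commutativeSemigroup; ≤-refl; ≤-reflexive; ≤-trans;
         <-irrefl; <-≤-trans; +-comm; +-suc; +-identityʳ; *-zeroʳ; *-identityʳ;
         +-mono-≤; +-monoˡ-≤; +-monoʳ-≤; m≤m+n; n≤1+n; n<1+n; m≤n⇒∃[o]m+o≡n)
open import Algebra.Properties.CommutativeSemigroup +-commutativeSemigroup using (interchange)
open import Data.Product using (Σ; _×_; _,_; proj₁; proj₂)
open import Data.Sum using (_⊎_; inj₁; inj₂)
open import Data.Vec using (Vec; []; _∷_; head; tail; init; _∷ʳ_; toList)
open import Data.Vec.Properties using (cast-is-id; init-∷ʳ; toList-∷ʳ; toList-injective; length-toList)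
open import Function using (_∘_; id)
open import Relation.Binary.Construct.Closure.Equivalence using (transitive; return)
  renaming (reflexive to refl*)
open import Relation.Binary.Construct.Closure.Transitive using (TransClosure; [_]; _∷_)
open import Relation.Binary.PropositionalEquality
open import Relation.Nullary using (¬_; Dec; yes; no; does; contradiction; ¬?)
open import Relation.Nullary.Decidable using (_×-dec_)

-- Written with if_then_else_ so that size σ M unfolds to ∑ (allWords σ (suc n)) (𝟙 ∘ M).
𝟙 : Bool → ℕ
𝟙 b = if b then 1 else 0

𝟙≤1 : ∀ b → 𝟙 b ≤ 1
𝟙≤1 true  = ≤-refl
𝟙≤1 false = z≤n

private
  variable
    A B : Set

∑ : List A → (A → ℕ) → ℕ
∑ xs φ = sum (map φ xs)

∑-cong : ∀ (xs : List A) {φ ψ : A → ℕ} → (∀ x → φ x ≡ ψ x) → ∑ xs φ ≡ ∑ xs ψ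
∑-cong []       eq = refl
∑-cong (x ∷ xs) eq = cong₂ _+_ (eq x) (∑-cong xs eq)

∑-mono : ∀ (xs : List A) {φ ψ : A → ℕ} → (∀ x → φ x ≤ ψ x) → ∑ xs φ ≤ ∑ xs ψ
∑-mono []       le = z≤n
∑-mono (x ∷ xs) le = +-mono-≤ (le x) (∑-mono xs le)

∑-distrib-+ : ∀ (xs : List A) (φ ψ : A → ℕ) → ∑ xs (λ x → φ x + ψ x) ≡ ∑ xs φ + ∑ xs ψ
∑-distrib-+ []       φ ψ = refl
∑-distrib-+ (x ∷ xs) φ ψ =
  trans (cong (φ x + ψ x +_) (∑-distrib-+ xs φ ψ)) (interchange (φ x) (ψ x) (∑ xs φ) (∑ xs ψ))

∑-const : ∀ (xs : List A) k → ∑ xs (λ _ → k) ≡ length xs * k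
∑-const []       k = refl
∑-const (x ∷ xs) k = cong (k +_) (∑-const xs k)

∑-zero : ∀ (xs : List A) → ∑ xs (λ _ → 0) ≡ 0
∑-zero xs = trans (∑-const xs 0) (*-zeroʳ (length xs))

∑-++ : ∀ (xs ys : List A) (φ : A → ℕ) → ∑ (xs ++ ys) φ ≡ ∑ xs φ + ∑ ys φ
∑-++ xs ys φ = trans (cong sum (map-++ φ xs ys)) (sum-++ (map φ xs) (map φ ys))

∑-map : (xs : List A) (g : A → B) (φ : B → ℕ) → ∑ (map g xs) φ ≡ ∑ xs (φ ∘ g)
∑-map []       g φ = refl
∑-map (x ∷ xs) g φ = cong (φ (g x) +_) (∑-map xs g φ)

∑-concatMap : (xs : List A) (F : A → List B) (φ : B → ℕ) →
              ∑ (concatMap F xs) φ ≡ ∑ xs (λ x → ∑ (F x) φ)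
∑-concatMap []       F φ = refl
∑-concatMap (x ∷ xs) F φ =
  trans (∑-++ (F x) (concatMap F xs) φ) (cong (∑ (F x) φ +_) (∑-concatMap xs F φ))

∑Fin : ∀ k → (Fin k → ℕ) → ℕ
∑Fin zero    φ = 0
∑Fin (suc k) φ = φ zero + ∑Fin k (φ ∘ suc)

∑Fin-cong : ∀ k {φ ψ : Fin k → ℕ} → (∀ a → φ a ≡ ψ a) → ∑Fin k φ ≡ ∑Fin k ψ
∑Fin-cong zero    eq = refl
∑Fin-cong (suc k) eq = cong₂ _+_ (eq zero) (∑Fin-cong k (eq ∘ suc))

∑Fin-const : ∀ k x → ∑Fin k (λ _ → x) ≡ k * x
∑Fin-const zero    x = refl
∑Fin-const (suc k) x = cong (x +_) (∑Fin-const k x)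

∑Fin-delta : ∀ k (b : Fin k) x → ∑Fin k (λ a → if does (a ≟F b) then x else 0) ≡ x
∑Fin-delta (suc k) zero    x = begin
  x + ∑Fin k (λ _ → 0) ≡⟨ cong (x +_) (∑Fin-const k 0) ⟩
  x + k * 0            ≡⟨ cong (x +_) (*-zeroʳ k) ⟩
  x + 0                ≡⟨ +-identityʳ x ⟩
  x                    ∎
  where open ≡-Reasoning
∑Fin-delta (suc k) (suc b) x = ∑Fin-delta k b x

∑-tabulate : ∀ k (g : Fin k → A) (φ : A → ℕ) → ∑ (tabulate g) φ ≡ ∑Fin k (φ ∘ g)
∑-tabulate zero    g φ = refl
∑-tabulate (suc k) g φ = cong (φ (g zero) +_) (∑-tabulate k (g ∘ suc) φ)

module _ {A : Set} where

  ++-cancelˡ-length : ∀ (p q : List A) {xs ys : List A} →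
                      length p ≡ length q → p ++ xs ≡ q ++ ys → xs ≡ ys
  ++-cancelˡ-length []      []      _   eq = eq
  ++-cancelˡ-length (_ ∷ p) (_ ∷ q) len eq =
    ++-cancelˡ-length p q (cong pred len) (∷-injectiveʳ eq)

  shiftIn : ∀ {n} → Vec A n → List A → Vec A n
  shiftIn h []       = h
  shiftIn h (a ∷ as) = shiftIn (tail (h ∷ʳ a)) as

  toList-head-tail : ∀ {n} (v : Vec A (suc n)) → head v ∷ toList (tail v) ≡ toList v
  toList-head-tail (x ∷ v) = refl

  shiftIn-suffix : ∀ {n} (h : Vec A n) as →
                   Σ (List A) λ p → length p ≡ length as × p ++ toList (shiftIn h as) ≡ toList h ++ as
  shiftIn-suffix h []       = [] , refl , sym (++-identityʳ (toList h))
  shiftIn-suffix h (a ∷ as) with shiftIn-suffix (tail (h ∷ʳ a)) as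
  ... | p , len , eq = head (h ∷ʳ a) ∷ p , cong suc len , (begin
    head (h ∷ʳ a) ∷ p ++ toList (shiftIn (tail (h ∷ʳ a)) as)
      ≡⟨ cong (head (h ∷ʳ a) ∷_) eq ⟩
    (head (h ∷ʳ a) ∷ toList (tail (h ∷ʳ a))) ++ as
      ≡⟨ cong (_++ as) (toList-head-tail (h ∷ʳ a)) ⟩
    toList (h ∷ʳ a) ++ as
      ≡⟨ cong (_++ as) (toList-∷ʳ a h) ⟩
    (toList h ++ a ∷ []) ++ as
      ≡⟨ ++-assoc (toList h) (a ∷ []) as ⟩
    toList h ++ a ∷ as ∎)
    where open ≡-Reasoning

  shiftIn-toList : ∀ {n} (h g : Vec A n) → shiftIn h (toList g) ≡ g
  shiftIn-toList h g with shiftIn-suffix h (toList g)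
  ... | p , len , eq = trans (sym (cast-is-id refl _)) (toList-injective refl _ _
    (++-cancelˡ-length p (toList h) (trans len (trans (length-toList g) (sym (length-toList h)))) eq))

  -- Any word is reached from any other of the same length n by shifting in its n letters.
  module _ {n} (c : Vec A n → ℕ) (c-step : ∀ (w : Vec A (suc n)) → c (tail w) ≤ suc (c (init w))) where

    c-shiftIn : ∀ h as → c (shiftIn h as) ≤ c h + length as
    c-shiftIn h []       = ≤-reflexive (sym (+-identityʳ (c h)))
    c-shiftIn h (a ∷ as) = begin
      c (shiftIn (tail (h ∷ʳ a)) as) ≤⟨ c-shiftIn (tail (h ∷ʳ a)) as ⟩
      c (tail (h ∷ʳ a)) + length as  ≤⟨ +-monoˡ-≤ (length as) one-step ⟩
      suc (c h) + length as          ≡⟨ sym (+-suc (c h) (length as)) ⟩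
      c h + suc (length as)          ∎
      where
      open ≤-Reasoning
      one-step : c (tail (h ∷ʳ a)) ≤ suc (c h)
      one-step = subst (λ v → c (tail (h ∷ʳ a)) ≤ suc (c v)) (init-∷ʳ a h) (c-step (h ∷ʳ a))

    c-≤-c+n : ∀ h g → c g ≤ c h + n
    c-≤-c+n h g = subst₂ _≤_ (cong c (shiftIn-toList h g)) (cong (c h +_) (length-toList g))
                    (c-shiftIn h (toList g))

module _ {A : Set} {N : ℕ} (encode : A → Fin N)
         (encode-injective : ∀ {x y} → encode x ≡ encode y → x ≡ y)
         (R : A → A → Set) (P : A → Set)
         (predecessor : ∀ {y} → P y → Σ A λ x → P x × R x y) where

  module _ {x₀ : A} (px₀ : P x₀) where

    private
      back : ℕ → Σ A P
      back zero    = x₀ , px₀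
      back (suc t) = let x , px , _ = predecessor (proj₂ (back t)) in x , px

      back-path : ∀ d t → TransClosure R (proj₁ (back (d + suc t))) (proj₁ (back t))
      back-path zero    t = [ proj₂ (proj₂ (predecessor (proj₂ (back t)))) ]
      back-path (suc d) t = proj₂ (proj₂ (predecessor (proj₂ (back (d + suc t))))) ∷ back-path d t

    cycle-from-predecessors : Σ A λ u → TransClosure R u u
    cycle-from-predecessors with pigeonhole (n<1+n N) (encode ∘ proj₁ ∘ back ∘ toℕ)
    ... | i , j , i<j , same with m≤n⇒∃[o]m+o≡n i<j
    ... | d , i+1+d≡j = proj₁ (back (toℕ j)) , subst₂ (TransClosure R) back-j back-i (back-path d (toℕ i))
      where
      back-j : proj₁ (back (d + suc (toℕ i))) ≡ proj₁ (back (toℕ j))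
      back-j = cong (proj₁ ∘ back) (trans (+-comm d (suc (toℕ i))) i+1+d≡j)

      back-i : proj₁ (back (toℕ i)) ≡ proj₁ (back (toℕ j))
      back-i = encode-injective same

module _ (σ : ℕ) where

  private
    _≟_ : ∀ {m} (u v : Word σ m) → Dec (u ≡ v)
    _≟_ = _≟W_ σ

  ∈-allWords : ∀ {m} (w : Word σ m) → w ∈ allWords σ m
  ∈-allWords []      = here refl
  ∈-allWords (a ∷ v) =
    ∈-concatMap⁺ (λ b → map (b ∷_) (allWords σ _)) (lose (∈-allFin a) (∈-map⁺ (a ∷_) (∈-allWords v)))

  encode : ∀ {m} → Word σ m → Fin (σ ^ m)
  encode []      = zero
  encode (a ∷ v) = combine a (encode v)

  encode-injective : ∀ {m} {u v : Word σ m} → encode u ≡ encode v → u ≡ v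
  encode-injective {u = []}    {[]}    _  = refl
  encode-injective {u = a ∷ u} {b ∷ v} eq with combine-injective a (encode u) b (encode v) eq
  ... | refl , eq′ = cong (a ∷_) (encode-injective eq′)

  ∑-allWords-suc : ∀ m (φ : Word σ (suc m) → ℕ) →
                   ∑ (allWords σ (suc m)) φ ≡ ∑Fin σ (λ a → ∑ (allWords σ m) (φ ∘ (a ∷_)))
  ∑-allWords-suc m φ = begin
    ∑ (allWords σ (suc m)) φ
      ≡⟨ ∑-concatMap (tabulate id) (λ a → map (a ∷_) (allWords σ m)) φ ⟩
    ∑ (tabulate id) (λ a → ∑ (map (a ∷_) (allWords σ m)) φ)
      ≡⟨ ∑-tabulate σ id _ ⟩
    ∑Fin σ (λ a → ∑ (map (a ∷_) (allWords σ m)) φ)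
      ≡⟨ ∑Fin-cong σ (λ a → ∑-map (allWords σ m) (a ∷_) φ) ⟩
    ∑Fin σ (λ a → ∑ (allWords σ m) (φ ∘ (a ∷_))) ∎
    where open ≡-Reasoning

  count-≡ : ∀ {m} (f : Word σ m) → ∑ (allWords σ m) (λ v → 𝟙 (does (v ≟ f))) ≡ 1
  count-≡ {zero}  []      = refl
  count-≡ {suc m} (b ∷ f) =
    trans (∑-allWords-suc m _) (trans (∑Fin-cong σ count-head) (∑Fin-delta σ b 1))
    where
    count-head : ∀ a → ∑ (allWords σ m) (λ v → 𝟙 (does ((a ∷ v) ≟ (b ∷ f))))
                       ≡ (if does (a ≟F b) then 1 else 0)
    count-head a with does (a ≟F b)
    ... | true  = count-≡ f
    ... | false = ∑-zero (allWords σ m)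

  count-tail : ∀ {m} (f : Word σ m) → ∑ (allWords σ (suc m)) (λ w → 𝟙 (does (tail w ≟ f))) ≡ σ
  count-tail {m} f = begin
    ∑ (allWords σ (suc m)) (λ w → 𝟙 (does (tail w ≟ f))) ≡⟨ ∑-allWords-suc m _ ⟩
    ∑Fin σ (λ _ → ∑ (allWords σ m) (λ v → 𝟙 (does (v ≟ f)))) ≡⟨ ∑Fin-cong σ (λ _ → count-≡ f) ⟩
    ∑Fin σ (λ _ → 1) ≡⟨ ∑Fin-const σ 1 ⟩
    σ * 1 ≡⟨ *-identityʳ σ ⟩
    σ ∎
    where open ≡-Reasoning

  count-init : ∀ {m} (f : Word σ m) → ∑ (allWords σ (suc m)) (λ w → 𝟙 (does (init w ≟ f))) ≡ σ
  count-init {zero}  []      = trans (∑-allWords-suc zero _) (trans (∑Fin-const σ 1) (*-identityʳ σ))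
  count-init {suc m} (b ∷ f) =
    trans (∑-allWords-suc (suc m) _) (trans (∑Fin-cong σ count-head) (∑Fin-delta σ b σ))
    where
    count-head : ∀ a → ∑ (allWords σ (suc m)) (λ v → 𝟙 (does (init (a ∷ v) ≟ (b ∷ f))))
                       ≡ (if does (a ≟F b) then σ else 0)
    count-head a with does (a ≟F b)
    ... | true  = count-init f
    ... | false = ∑-zero (allWords σ (suc m))

  module _ {n : ℕ} (g : Word σ n) (M : VSet σ n) where

    move-init : ∀ {w} → init w ≡ g → move σ g M w ≡ true
    move-init {w} eq with init w ≟ g
    ... | yes _  = refl
    ... | no neq = contradiction eq neq

    move-source∉ : ∀ {x y} → EdgeOutside σ (move σ g M) x y → M x ≡ false
    move-source∉ {x} {y} (x∉ , y∉ , tail≡init) with tail x ≟ g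
    ... | yes tail≡g = contradiction (trans (sym (move-init (trans (sym tail≡init) tail≡g))) y∉) λ ()
    ... | no  _      = ∨-conicalʳ (does (init x ≟ g)) (M x) x∉

    move-preserves-Decycling : Decycling σ M → Decycling σ (move σ g M)
    move-preserves-Decycling acyclic u cycle = acyclic u (lift-walk cycle (first-edge cycle))
      where
      E′ = EdgeOutside σ (move σ g M)

      first-edge : ∀ {x y} → TransClosure E′ x y → Σ (Word σ (suc n)) (E′ x)
      first-edge [ e ]   = _ , e
      first-edge (e ∷ _) = _ , e

      lift-edge : ∀ {x y z} → E′ x y → E′ y z → EdgeOutside σ M x y
      lift-edge e e′ = move-source∉ e , move-source∉ e′ , proj₂ (proj₂ e)

      lift-walk : ∀ {x y} → TransClosure E′ x y → Σ (Word σ (suc n)) (E′ y) → TransClosure (EdgeOutside σ M) x y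
      lift-walk [ e ]    (_ , e′) = [ lift-edge e e′ ]
      lift-walk (e ∷ es) next     = lift-edge e (proj₂ (first-edge es)) ∷ lift-walk es next

    module _ (valid : Valid σ g M) where

      private
        lc rc kept : Word σ (suc n) → Bool
        lc w   = does (tail w ≟ g)
        rc w   = does (init w ≟ g)
        kept w = not (lc w) ∧ M w

      𝟙-M-split : ∀ w → 𝟙 (M w) ≡ 𝟙 (kept w) + 𝟙 (lc w)
      𝟙-M-split (a ∷ v) with v ≟ g
      ... | yes refl rewrite valid a = refl
      ... | no  _    = sym (+-identityʳ _)

      𝟙-move≤ : ∀ w → 𝟙 (move σ g M w) ≤ 𝟙 (rc w) + 𝟙 (kept w)
      𝟙-move≤ w with rc w
      ... | true  = s≤s z≤n
      ... | false = ≤-refl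

      size-move≤size : size σ (move σ g M) ≤ size σ M
      size-move≤size = begin
        size σ (move σ g M)                 ≤⟨ ∑-mono words 𝟙-move≤ ⟩
        ∑ words (λ w → 𝟙 (rc w) + 𝟙 (kept w)) ≡⟨ ∑-distrib-+ words _ _ ⟩
        ∑ words (𝟙 ∘ rc) + ∑ words (𝟙 ∘ kept) ≡⟨ cong (_+ ∑ words (𝟙 ∘ kept)) |rc|≡|lc| ⟩
        ∑ words (𝟙 ∘ lc) + ∑ words (𝟙 ∘ kept) ≡⟨ +-comm (∑ words (𝟙 ∘ lc)) _ ⟩
        ∑ words (𝟙 ∘ kept) + ∑ words (𝟙 ∘ lc) ≡⟨ sym (∑-distrib-+ words _ _) ⟩
        ∑ words (λ w → 𝟙 (kept w) + 𝟙 (lc w)) ≡⟨ sym (∑-cong words 𝟙-M-split) ⟩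
        size σ M                            ∎
        where
        open ≤-Reasoning
        words = allWords σ (suc n)
        |rc|≡|lc| : ∑ words (𝟙 ∘ rc) ≡ ∑ words (𝟙 ∘ lc)
        |rc|≡|lc| = trans (count-init g) (sym (count-tail g))

      move-preserves-MDS : MDS σ M → MDS σ (move σ g M)
      move-preserves-MDS (acyclic , minimal) =
        move-preserves-Decycling acyclic , λ N N-acyclic → ≤-trans size-move≤size (minimal N N-acyclic)

      move-edge : MDS σ M → MDSEdge σ M (move σ g M)
      move-edge mds = mds , move-preserves-MDS mds , g , valid , λ _ → refl

  valid? : ∀ {n} (g : Word σ n) (M : VSet σ n) → Dec (Valid σ g M)
  valid? g M = all? (λ a → M (a ∷ g) ≟B true)

  module _ {n : ℕ} (M : VSet σ n) where

    no-valid-move⇒cycle : (∀ g → ¬ Valid σ g M) → Word σ n →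
                          Σ (Word σ (suc n)) λ u → TransClosure (EdgeOutside σ M) u u
    no-valid-move⇒cycle invalid g₀ =
      cycle-from-predecessors encode encode-injective (EdgeOutside σ M) (λ w → M w ≡ false)
        predecessor (proj₂ (letter-outside g₀))
      where
      letter-outside : ∀ g → Σ (Fin σ) λ a → M (a ∷ g) ≡ false
      letter-outside g with ¬∀⟶∃¬ σ _ (λ a → M (a ∷ g) ≟B true) (invalid g)
      ... | a , ¬in = a , ¬-not ¬in

      predecessor : ∀ {y} → M y ≡ false → Σ (Word σ (suc n)) λ x → M x ≡ false × EdgeOutside σ M x y
      predecessor {y} y∉ with letter-outside (init y)
      ... | a , x∉ = a ∷ init y , x∉ , x∉ , y∉ , refl

    valid-move : Decycling σ M → Word σ n → Σ (Word σ n) λ g → Valid σ g M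
    valid-move acyclic g₀ with any? (λ g → valid? g M) (allWords σ n)
    ... | yes some = satisfied some
    ... | no  none =
      let u , cycle = no-valid-move⇒cycle (λ g v → none (lose (∈-allWords g) v)) g₀
      in ⊥-elim (acyclic u cycle)

    other-valid-move? : (f : Word σ n) →
                        (Σ (Word σ n) λ g → Valid σ g M × ¬ g ≡ f) ⊎ (∀ g → Valid σ g M → g ≡ f)
    other-valid-move? f with any? (λ g → valid? g M ×-dec ¬? (g ≟ f)) (allWords σ n)
    ... | yes some = inj₁ (satisfied some)
    ... | no  none = inj₂ only-f
      where
      only-f : ∀ g → Valid σ g M → g ≡ f
      only-f g v with g ≟ f
      ... | yes eq = eq
      ... | no neq = ⊥-elim (none (lose (∈-allWords g) (v , neq)))

  module Search {n : ℕ} (f : Word σ n) (M₀ : VSet σ n) where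

    tick : (Word σ n → ℕ) → Word σ n → Word σ n → ℕ
    tick c g v = c v + 𝟙 (does (v ≟ g))

    -- Applying g removes the words w with tail w ≡ g and adds those with init w ≡ g. With
    -- c counting applications since M₀, w can thus have left M₀ at most as often as
    -- c (tail w) exceeds c (init w). Constant words lie in both lc and rc and are excluded.
    Balanced : VSet σ n → (Word σ n → ℕ) → Set
    Balanced M c = ∀ w → ¬ init w ≡ tail w → c (tail w) + 𝟙 (M w) ≤ c (init w) + 𝟙 (M₀ w)

    balanced-step : ∀ {M c} → Balanced M c → ∀ w → c (tail w) ≤ suc (c (init w))
    balanced-step {M} {c} bal w with init w ≟ tail w
    ... | yes eq rewrite eq = n≤1+n _
    ... | no neq = begin
      c (tail w)                ≤⟨ m≤m+n _ _ ⟩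
      c (tail w) + 𝟙 (M w)       ≤⟨ bal w neq ⟩
      c (init w) + 𝟙 (M₀ w)      ≤⟨ +-monoʳ-≤ (c (init w)) (𝟙≤1 (M₀ w)) ⟩
      c (init w) + 1            ≡⟨ +-comm (c (init w)) 1 ⟩
      suc (c (init w))          ∎
      where open ≤-Reasoning

    balanced-move : ∀ {M c g} → Valid σ g M → Balanced M c → Balanced (move σ g M) (tick c g)
    balanced-move {M} {c} {g} valid bal (x ∷ v) neq with init (x ∷ v) ≟ g | v ≟ g
    ... | yes init≡g | yes v≡g = contradiction (trans init≡g (sym v≡g)) neq
    ... | yes refl   | no  _   = begin
      c v + 0 + 1                         ≡⟨ cong (_+ 1) (+-identityʳ (c v)) ⟩
      c v + 1                             ≡⟨ +-comm (c v) 1 ⟩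
      suc (c v)                           ≤⟨ s≤s (≤-trans (m≤m+n (c v) _) (bal (x ∷ v) neq)) ⟩
      suc (c (init (x ∷ v)) + 𝟙 (M₀ (x ∷ v))) ≡⟨ cong (_+ 𝟙 (M₀ (x ∷ v))) (+-comm 1 _) ⟩
      c (init (x ∷ v)) + 1 + 𝟙 (M₀ (x ∷ v)) ∎
      where open ≤-Reasoning
    ... | no  _      | yes refl = begin
      c g + 1 + 0                         ≡⟨ +-identityʳ (c g + 1) ⟩
      c g + 𝟙 true                        ≡⟨ cong (λ b → c g + 𝟙 b) (sym (valid x)) ⟩
      c g + 𝟙 (M (x ∷ g))                 ≤⟨ bal (x ∷ g) neq ⟩
      c (init (x ∷ g)) + 𝟙 (M₀ (x ∷ g))     ≡⟨ cong (_+ 𝟙 (M₀ (x ∷ g))) (sym (+-identityʳ _)) ⟩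
      c (init (x ∷ g)) + 0 + 𝟙 (M₀ (x ∷ g)) ∎
      where open ≤-Reasoning
    ... | no  _      | no  _    = begin
      c v + 0 + 𝟙 (M (x ∷ v))               ≡⟨ cong (_+ 𝟙 (M (x ∷ v))) (+-identityʳ (c v)) ⟩
      c v + 𝟙 (M (x ∷ v))                   ≤⟨ bal (x ∷ v) neq ⟩
      c (init (x ∷ v)) + 𝟙 (M₀ (x ∷ v))     ≡⟨ cong (_+ 𝟙 (M₀ (x ∷ v))) (sym (+-identityʳ _)) ⟩
      c (init (x ∷ v)) + 0 + 𝟙 (M₀ (x ∷ v)) ∎
      where open ≤-Reasoning

    record Stage : Set where
      field
        current   : VSet σ n
        applied   : Word σ n → ℕ
        isMDS     : MDS σ current
        reached   : SameComponent σ M₀ current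
        f-unused  : applied f ≡ 0
        balanced  : Balanced current applied

    open Stage

    total : Stage → ℕ
    total s = ∑ (allWords σ n) (applied s)

    total-bounded : ∀ s → total s ≤ length (allWords σ n) * n
    total-bounded s = ≤-trans (∑-mono (allWords σ n) applied≤n) (≤-reflexive (∑-const (allWords σ n) n))
      where
      applied≤n : ∀ g → applied s g ≤ n
      applied≤n g = subst (λ t → applied s g ≤ t + n) (f-unused s)
        (c-≤-c+n (applied s) (balanced-step {current s} {applied s} (balanced s)) f g)

    advance : (s : Stage) (g : Word σ n) → Valid σ g (current s) → ¬ g ≡ f → Stage
    advance s g valid g≢f = record
      { current  = move σ g (current s)
      ; applied  = tick (applied s) g
      ; isMDS    = move-preserves-MDS g (current s) valid (isMDS s)
      ; reached  = transitive (MDSEdge σ) (reached s) (return (move-edge g (current s) valid (isMDS s)))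
      ; f-unused = f-still-unused
      ; balanced = balanced-move {current s} {applied s} valid (balanced s)
      }
      where
      f-still-unused : tick (applied s) g f ≡ 0
      f-still-unused with f ≟ g
      ... | yes f≡g = contradiction (sym f≡g) g≢f
      ... | no  _   = trans (+-identityʳ _) (f-unused s)

    total-advance : ∀ s g valid g≢f → total (advance s g valid g≢f) ≡ suc (total s)
    total-advance s g _ _ = begin
      ∑ (allWords σ n) (tick (applied s) g)                       ≡⟨ ∑-distrib-+ (allWords σ n) _ _ ⟩
      total s + ∑ (allWords σ n) (λ v → 𝟙 (does (v ≟ g)))          ≡⟨ cong (total s +_) (count-≡ g) ⟩
      total s + 1                                                 ≡⟨ +-comm (total s) 1 ⟩
      suc (total s)                                               ∎
      where open ≡-Reasoning

    Goal : Set
    Goal = Σ (VSet σ n) λ T → SameComponent σ M₀ T × Terminal σ f T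

    search : ∀ fuel (s : Stage) → length (allWords σ n) * n < fuel + total s → Goal
    search zero       s exhausted = ⊥-elim (<-irrefl refl (<-≤-trans exhausted (total-bounded s)))
    search (suc fuel) s fueled with other-valid-move? (current s) f
    ... | inj₁ (g , valid , g≢f) = search fuel (advance s g valid g≢f)
          (subst (length (allWords σ n) * n <_)
                 (trans (sym (+-suc fuel (total s))) (cong (fuel +_) (sym (total-advance s g valid g≢f))))
                 fueled)
    ... | inj₂ only-f =
      let g , valid = valid-move (current s) (proj₁ (isMDS s)) f
      in current s , reached s , isMDS s , subst (λ h → Valid σ h (current s)) (only-f g valid) valid , only-f

    start : MDS σ M₀ → Stage
    start mds = record
      { current  = M₀
      ; applied  = λ _ → 0
      ; isMDS    = mds
      ; reached  = refl* (MDSEdge σ)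
      ; f-unused = refl
      ; balanced = λ _ _ → ≤-refl
      }

    terminal-in-component : MDS σ M₀ → Goal
    terminal-in-component mds = search (suc (length (allWords σ n) * n)) (start mds)
      (subst (length (allWords σ n) * n <_)
             (sym (trans (cong (suc (length (allWords σ n) * n) +_) (∑-zero (allWords σ n))) (+-identityʳ _)))
             ≤-refl)

lemma2 : (σ n : ℕ) → 2 ≤ σ → 2 ≤ suc n →
         (f : Word σ n) → (M : VSet σ n) → MDS σ M →
         Σ (VSet σ n) (λ T → SameComponent σ M T × Terminal σ f T)
lemma2 σ n _ _ f M mds = Search.terminal-in-component σ f M mds
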